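{- Let $D$ be a tournament. Then either $\mathrm{inv}(D)=\mathrm{tmr}(D)$, or $\mathrm{inv}(D)=\mathrm{tmr}(D)+1$, in which case $\mathrm{tmr}(D)$ is even. Moreover, if $D$ is not transitive, then $\mathrm{inv}(D)=\mathrm{tmr}(D)+1$ if and only if every matrix $M\in\mathcal{M}^*(D)$ of rank $\mathrm{tmr}(D)$ has every diagonal entry equal to zero.
   Context: A tournament is an oriented graph with exactly one of the edges $uv$, $vu$ for every pair of distinct vertices; it is transitive if it is acyclic. For $X\subseteq V(D)$, inverting $X$ reverses every edge with both endpoints in $X$; $\mathrm{inv}(D)$ is the minimum number of sets whose successive inversion yields an acyclic oriented graph. All ranks are over $\mathbb{F}_2$. For an undirected graph $G$ on $n$ vertices, $\mathcal{M}(G)$ is the set of $n\times n$ $\{0,1\}$-matrices obtained from the adjacency matrix of $G$ by arbitrarily altering diagonal entries. For a tournament $D$ on vertex set $V$ with $|V|=n$ and a transitive tournament $T$ on $V$, $G_{D,T}$ is the undirected graph on $V$ in which $ij$ is an edge iff the edge between $i$ and $j$ has opposite orientations in $D$ and $T$. $\mathcal{M}^*(D)=\bigcup_T \mathcal{M}(G_{D,T})$, the union over all transitive tournaments $T$ on $V$, and the tournament minimum rank is $\mathrm{tmr}(D)=\min\{\mathrm{rank}(M): M\in\mathcal{M}^*(D)\}$. -}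

module Defs where

open import Data.Nat using (ℕ; zero; suc; _≤_)
open import Data.Fin using (Fin; zero; suc; inject₁; fromℕ)
open import Data.Bool using (Bool; true; false; _∧_; _xor_; if_then_else_)
open import Data.List using (List; []; _∷_; length)
open import Data.Product using (Σ; _×_; _,_)
open import Data.Sum using (_⊎_)
open import Relation.Nullary using (¬_)
open import Relation.Binary.PropositionalEquality using (_≡_; _≢_)

-- A digraph on vertex set Fin n: D i j ≡ true iff there is an edge i → j.
Digraph : ℕ → Set
Digraph n = Fin n → Fin n → Bool

-- Oriented graph: no loops, no pair of opposite edges (i=j gives irreflexivity).
IsOriented : ∀ {n} → Digraph n → Set
IsOriented {n} D = (i j : Fin n) → D i j ≡ true → D j i ≡ false

IsTournament : ∀ {n} → Digraph n → Set
IsTournament {n} D =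
  IsOriented D × ((i j : Fin n) → i ≢ j → (D i j ≡ true) ⊎ (D j i ≡ true))

-- A closed directed walk of length suc k: w 0 → w 1 → … → w k → w 0.
HasCycle : ∀ {n} → Digraph n → Set
HasCycle {n} D =
  Σ ℕ λ k → Σ (Fin (suc k) → Fin n) λ w →
    ((i : Fin k) → D (w (inject₁ i)) (w (suc i)) ≡ true)
    × (D (w (fromℕ k)) (w zero) ≡ true)

Acyclic : ∀ {n} → Digraph n → Set
Acyclic D = ¬ HasCycle D

IsTransitiveTournament : ∀ {n} → Digraph n → Set
IsTransitiveTournament D = IsTournament D × Acyclic D

VSet : ℕ → Set
VSet n = Fin n → Bool

invert : ∀ {n} → Digraph n → VSet n → Digraph n
invert D X i j = if X i ∧ X j then D j i else D i j

invertAll : ∀ {n} → Digraph n → List (VSet n) → Digraph n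
invertAll D [] = D
invertAll D (X ∷ Xs) = invertAll (invert D X) Xs

IsInv : ∀ {n} → Digraph n → ℕ → Set
IsInv {n} D k =
  (Σ (List (VSet n)) λ Xs → (length Xs ≡ k) × Acyclic (invertAll D Xs))
  × ((Xs : List (VSet n)) → Acyclic (invertAll D Xs) → k ≤ length Xs)

-- Square {0,1}-matrices, viewed over F₂ (true = 1, xor = +, ∧ = ·).
Matrix : ℕ → Set
Matrix n = Fin n → Fin n → Bool

xsum : ∀ {k} → (Fin k → Bool) → Bool
xsum {zero} g = false
xsum {suc k} g = g zero xor xsum (λ i → g (suc i))

RowsIndependent : ∀ {n k} → Matrix n → (Fin k → Fin n) → Set
RowsIndependent {n} {k} M f =
  (c : Fin k → Bool) →
  ((j : Fin n) → xsum (λ i → c i ∧ M (f i) j) ≡ false) →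
  (i : Fin k) → c i ≡ false

IsRank : ∀ {n} → Matrix n → ℕ → Set
IsRank {n} M r =
  (Σ (Fin r → Fin n) λ f → RowsIndependent M f)
  × ((k : ℕ) (f : Fin k → Fin n) → RowsIndependent M f → k ≤ r)

-- G_{D,T}: ij is an edge iff the edge between i and j is oriented oppositely in D and T.
G : ∀ {n} → Digraph n → Digraph n → Fin n → Fin n → Bool
G D T i j = D i j xor T i j

InM : ∀ {n} → (Fin n → Fin n → Bool) → Matrix n → Set
InM {n} A M = (i j : Fin n) → i ≢ j → M i j ≡ A i j

InMstar : ∀ {n} → Digraph n → Matrix n → Set
InMstar {n} D M = Σ (Digraph n) λ T → IsTransitiveTournament T × InM (G D T) M

IsTmr : ∀ {n} → Digraph n → ℕ → Set
IsTmr {n} D r =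
  (Σ (Matrix n) λ M → InMstar D M × IsRank M r)
  × ((M : Matrix n) (s : ℕ) → InMstar D M → IsRank M s → r ≤ s)

MinRankZeroDiag : ∀ {n} → Digraph n → ℕ → Set
MinRankZeroDiag {n} D r =
  (M : Matrix n) → InMstar D M → IsRank M r → (i : Fin n) → M i i ≡ false

module Submission where

-- Inverting X₁, …, X_m flips the edge ij once for every X_l that contains both i and j, so over F₂
-- the result differs from D, off the diagonal, by X Xᵀ where X is the n × m incidence matrix of the
-- family. An inversion family turning D into a transitive tournament T is therefore the same thing
-- as a factorization M = X Xᵀ of some M ∈ 𝓜(G_{D,T}), the diagonal of M being free. A symmetric
-- matrix of rank r over F₂ factors with r columns when its diagonal is nonzero and with r + 1 columns
-- in any case (pass to an invertible principal submatrix, then split off a diagonal pivot, or a 2 × 2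
-- block when the diagonal vanishes). Conversely X Xᵀ has rank at most m, and at most m − 1 when its
-- diagonal vanishes, because then every row of X has even weight; the same bound shows that
-- alternating matrices have even rank.

open import Defs
open import Data.Nat using (ℕ; zero; suc; _≤_; _<_; z≤n; s≤s; _+_; _≤′_; ≤′-refl; ≤′-step)
open import Data.Nat.Properties
  using (≤-trans; ≤-antisym; ≤-pred; ≤∧≢⇒<; ≮⇒≥; <-≤-trans; m≤n⇒m<n∨m≡n; n≤1+n; 1+n≰n; m<n⇒m<1+n;
         ≤⇒≤′; +-suc; +-identityʳ)
  renaming (_≟_ to _≟ℕ_)
open import Data.Fin using (Fin; zero; suc; punchIn; lift; inject₁; fromℕ)
open import Data.Fin.Properties using (any?; all?) renaming (_≟_ to _≟ᶠ_)
open import Data.Bool using (Bool; true; false; _∧_; _xor_; not)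
open import Data.Bool.Properties
  using (xor-∧-commutativeRing; ¬-not; not-involutive; ∧-zeroʳ; ∧-identityʳ; ∧-idem; ∧-comm; ∧-assoc;
         xor-identityʳ; xor-same; xor-comm; xor-assoc; ∧-distribˡ-xor)
  renaming (_≟_ to _≟ᵇ_)
open import Data.Nat.Divisibility using (_∣_; divides)
open import Data.Sum using (_⊎_; inj₁; inj₂; [_,_]′)
open import Data.List using (List; []; _∷_; length)
open import Data.Product using (Σ; ∃; _×_; _,_; proj₁; proj₂; map₂)
open import Data.Fin.Permutation.Components using (transpose; transpose-inverse)
open import Data.Vec.Functional using (insertAt) renaming (_∷_ to _∷ᶠ_)
open import Data.Vec.Functional.Properties using (insertAt-lookup; insertAt-punchIn)
open import Data.Vec.Functional.Relation.Binary.Pointwise using (Pointwise)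
open import Algebra.Bundles using (CommutativeRing)
open import Algebra.Solver.Ring.AlmostCommutativeRing using (fromCommutativeRing)
open import Relation.Nullary using (¬_; Dec; yes; no; contradiction)
open import Relation.Nullary.Decidable using (map′; ¬?; _×-dec_; _→-dec_)
open import Relation.Unary using (Decidable)
open import Relation.Binary.Definitions using (_Respects_)
open import Relation.Binary.PropositionalEquality hiding (resp)
open import Function.Bundles using (_⇔_; mk⇔)

open import Algebra.Properties.Semiring.Sum (CommutativeRing.semiring xor-∧-commutativeRing)
  using (sum; sum-syntax; sum-cong-≗; ∑-distrib-+; ∑-comm; *-distribˡ-sum; *-distribʳ-sum;
         sum-remove; sum-replicate-zero)
open import Algebra.Solver.Ring.Simple (fromCommutativeRing xor-∧-commutativeRing) _≟ᵇ_
  using (solve; _:+_; _:*_; _:=_; con)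

-- Finite search

Searchable : (A : Set) → (A → A → Set) → Set₁
Searchable A _≈_ = (P : A → Set) → P Respects _≈_ → Decidable P → Dec (∃ P)

Bool-searchable : Searchable Bool _≡_
Bool-searchable P _ P? with P? true | P? false
... | yes p | _     = yes (true , p)
... | no _  | yes q = yes (false , q)
... | no ¬p | no ¬q = no λ { (true , p) → ¬p p ; (false , q) → ¬q q }

Fin-searchable : ∀ {n} → Searchable (Fin n) _≡_
Fin-searchable P _ P? = any? P?

Π-searchable : ∀ {A : Set} {_≈_ : A → A → Set} → (∀ {x} → x ≈ x) →
  Searchable A _≈_ → ∀ k → Searchable (Fin k → A) (Pointwise _≈_ {k})
Π-searchable ≈-refl S zero P resp P? with P? (λ ())
... | yes p = yes (_ , p)
... | no ¬p = no λ (f , pf) → ¬p (resp (λ ()) pf)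
Π-searchable {A} {_≈_} ≈-refl S (suc k) P resp P? =
  map′ (λ (x , g , p) → x ∷ᶠ g , p) (λ (f , p) → f zero , (λ i → f (suc i)) , resp split p)
    (S Q respQ Q?)
  where
  Q : A → Set
  Q x = ∃ λ g → P (x ∷ᶠ g)
  respQ : Q Respects _≈_
  respQ x≈y (g , p) = g , resp (λ { zero → x≈y ; (suc i) → ≈-refl }) p
  Q? : Decidable Q
  Q? x = Π-searchable ≈-refl S k (λ g → P (x ∷ᶠ g))
    (λ g≈h → resp λ { zero → ≈-refl ; (suc i) → g≈h i }) (λ g → P? (x ∷ᶠ g))
  split : ∀ {f : Fin (suc k) → A} → Pointwise _≈_ f (f zero ∷ᶠ (λ i → f (suc i)))
  split zero = ≈-refl
  split (suc i) = ≈-refl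

Least : (ℕ → Set) → ℕ → Set
Least P r = P r × (∀ s → P s → r ≤ s)

Greatest : (ℕ → Set) → ℕ → Set
Greatest P r = P r × (∀ s → P s → s ≤ r)

least : ∀ {P : ℕ → Set} → Decidable P → ∀ m → P m → ∃ (Least P)
least {P} P? m pm = search m 0 (λ _ ()) (subst P (sym (+-identityʳ m)) pm)
  where
  search : ∀ d s → (∀ t → t < s → ¬ P t) → P (d + s) → ∃ (Least P)
  search d s below pds with P? s
  ... | yes ps = s , ps , λ t pt → ≮⇒≥ (λ t<s → below t t<s pt)
  search zero s below ps | no ¬ps = contradiction ps ¬ps
  search (suc d) s below pds | no ¬ps =
    search d (suc s) below′ (subst P (sym (+-suc d s)) pds)
    where
    below′ : ∀ t → t < suc s → ¬ P t
    below′ t t<1+s with t ≟ℕ s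
    ... | yes refl = ¬ps
    ... | no t≢s = below t (≤∧≢⇒< (≤-pred t<1+s) t≢s)

greatest : ∀ {P : ℕ → Set} → Decidable P → P 0 → ∀ b → (∀ s → P s → s ≤ b) → ∃ (Greatest P)
greatest P? p0 zero bound = 0 , p0 , bound
greatest P? p0 (suc b) bound with P? (suc b)
... | yes p = suc b , p , bound
... | no ¬p = greatest P? p0 b λ s ps → ≤-pred (≤∧≢⇒< (bound s ps) λ { refl → ¬p ps })

-- Linear algebra over F₂

xsum≡sum : ∀ {k} (f : Fin k → Bool) → xsum f ≡ sum f
xsum≡sum {zero} f = refl
xsum≡sum {suc k} f = cong (f zero xor_) (xsum≡sum (λ i → f (suc i)))

Mat : ℕ → ℕ → Set
Mat k m = Fin k → Fin m → Bool

infix 10 _ᵀ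
infixl 7 _⊙_
infix 4 _≐_

_ᵀ : ∀ {k m} → Mat k m → Mat m k
(X ᵀ) l i = X i l

_⊙_ : ∀ {k m n} → Mat k m → Mat m n → Mat k n
_⊙_ {m = m} A B i j = ∑[ l < m ] (A i l ∧ B l j)

_≐_ : ∀ {k m} → Mat k m → Mat k m → Set
A ≐ B = ∀ i j → A i j ≡ B i j

Gram : ∀ {k m} → Mat k m → Mat k k
Gram X = X ⊙ X ᵀ

Dependent : ∀ {k n} → Mat k n → Set
Dependent {k} {n} v =
  Σ (Fin k → Bool) λ c → (∀ j → ∑[ i < k ] (c i ∧ v i j) ≡ false) × ∃ λ i → c i ≡ true

dependent-after-elimination : ∀ {k n} (v : Mat (suc k) n) i₀ (α : Fin k → Bool) →
  Dependent (λ i j → v (punchIn i₀ i) j xor (α i ∧ v i₀ j)) → Dependent v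
dependent-after-elimination {k} v i₀ α (c′ , c′v≡0 , i₁ , c′i₁) =
  c , cv≡0 , punchIn i₀ i₁ , trans (insertAt-punchIn c′ i₀ β i₁) c′i₁
  where
  β = ∑[ i < k ] (c′ i ∧ α i)
  c = insertAt c′ i₀ β
  cv≡0 : ∀ j → ∑[ i < suc k ] (c i ∧ v i j) ≡ false
  cv≡0 j = begin
    ∑[ i < suc k ] (c i ∧ v i j)
      ≡⟨ sum-remove {i = i₀} (λ i → c i ∧ v i j) ⟩
    (c i₀ ∧ v i₀ j) xor ∑[ i < k ] (c (punchIn i₀ i) ∧ v (punchIn i₀ i) j)
      ≡⟨ cong₂ (λ x y → (x ∧ v i₀ j) xor y) (insertAt-lookup c′ i₀ β)
           (sum-cong-≗ λ i → cong (_∧ v (punchIn i₀ i) j) (insertAt-punchIn c′ i₀ β i)) ⟩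
    (β ∧ v i₀ j) xor ∑[ i < k ] (c′ i ∧ v (punchIn i₀ i) j)
      ≡⟨ cong (_xor _) (*-distribʳ-sum (v i₀ j) (λ i → c′ i ∧ α i)) ⟩
    ∑[ i < k ] ((c′ i ∧ α i) ∧ v i₀ j) xor ∑[ i < k ] (c′ i ∧ v (punchIn i₀ i) j)
      ≡⟨ sym (∑-distrib-+ (λ i → (c′ i ∧ α i) ∧ v i₀ j) (λ i → c′ i ∧ v (punchIn i₀ i) j)) ⟩
    ∑[ i < k ] (((c′ i ∧ α i) ∧ v i₀ j) xor (c′ i ∧ v (punchIn i₀ i) j))
      ≡⟨ sum-cong-≗ (λ i → regroup (c′ i) (α i) (v i₀ j) (v (punchIn i₀ i) j)) ⟩
    ∑[ i < k ] (c′ i ∧ (v (punchIn i₀ i) j xor (α i ∧ v i₀ j)))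
      ≡⟨ c′v≡0 j ⟩
    false ∎
    where
    open ≡-Reasoning
    regroup : ∀ c a x y → ((c ∧ a) ∧ x) xor (c ∧ y) ≡ c ∧ (y xor (a ∧ x))
    regroup = solve 4 (λ c a x y → ((c :* a) :* x) :+ (c :* y) := c :* (y :+ (a :* x))) refl

-- Gaussian elimination of the first generator, using a row in which it occurs as pivot.
fewer-generators⇒dependent : ∀ {n} m {k} (a : Mat k m) (w : Mat m n) (v : Mat k n) →
  v ≐ a ⊙ w → m < k → Dependent v
fewer-generators⇒dependent zero {suc k} a w v v≐aw _ =
  (λ _ → true) , (λ j → trans (sum-cong-≗ (λ i → v≐aw i j)) (sum-replicate-zero (suc k))) , zero , refl
fewer-generators⇒dependent (suc m) {suc k} a w v v≐aw (s≤s m<k)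
  with any? (λ i → a i zero ≟ᵇ true)
... | no no-pivot =
  fewer-generators⇒dependent m (λ i l → a i (suc l)) (λ l → w (suc l)) v v≐a′w′ (m<n⇒m<1+n m<k)
  where
  v≐a′w′ : v ≐ (λ i l → a i (suc l)) ⊙ (λ l → w (suc l))
  v≐a′w′ i j = trans (v≐aw i j)
    (cong (λ x → (x ∧ w zero j) xor ∑[ l < m ] (a i (suc l) ∧ w (suc l) j))
          (¬-not λ aᵢ₀ → no-pivot (i , aᵢ₀)))
fewer-generators⇒dependent {n} (suc m) {suc (suc k)} a w v v≐aw (s≤s m<k) | yes (i₀ , pivot) =
  dependent-after-elimination v i₀ α
    (fewer-generators⇒dependent m a′ (λ l → w (suc l)) _ reduced m<k)
  where
  open ≡-Reasoning
  α : Fin (suc k) → Bool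
  α i = a (punchIn i₀ i) zero
  a′ : Mat (suc k) m
  a′ i l = a (punchIn i₀ i) (suc l) xor (α i ∧ a i₀ (suc l))
  rest : Fin (suc (suc k)) → Fin n → Bool
  rest i j = ∑[ l < m ] (a i (suc l) ∧ w (suc l) j)
  reduced : (λ i j → v (punchIn i₀ i) j xor (α i ∧ v i₀ j)) ≐ a′ ⊙ (λ l → w (suc l))
  reduced i j = begin
    v (punchIn i₀ i) j xor (α i ∧ v i₀ j)
      ≡⟨ cong₂ (λ x y → x xor (α i ∧ y)) (v≐aw (punchIn i₀ i) j) (v≐aw i₀ j) ⟩
    ((α i ∧ w zero j) xor rest (punchIn i₀ i) j) xor (α i ∧ ((a i₀ zero ∧ w zero j) xor rest i₀ j))
      ≡⟨ cong (λ p → ((α i ∧ w zero j) xor rest (punchIn i₀ i) j) xor (α i ∧ ((p ∧ w zero j) xor rest i₀ j)))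
              pivot ⟩
    ((α i ∧ w zero j) xor rest (punchIn i₀ i) j) xor (α i ∧ (w zero j xor rest i₀ j))
      ≡⟨ cancel (α i) (w zero j) _ _ ⟩
    rest (punchIn i₀ i) j xor (α i ∧ rest i₀ j)
      ≡⟨ cong (rest (punchIn i₀ i) j xor_) (*-distribˡ-sum (α i) (λ l → a i₀ (suc l) ∧ w (suc l) j)) ⟩
    rest (punchIn i₀ i) j xor ∑[ l < m ] (α i ∧ (a i₀ (suc l) ∧ w (suc l) j))
      ≡⟨ sym (∑-distrib-+ (λ l → a (punchIn i₀ i) (suc l) ∧ w (suc l) j) _) ⟩
    ∑[ l < m ] ((a (punchIn i₀ i) (suc l) ∧ w (suc l) j) xor (α i ∧ (a i₀ (suc l) ∧ w (suc l) j)))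
      ≡⟨ sum-cong-≗ (λ l → distrib (a (punchIn i₀ i) (suc l)) (α i) (a i₀ (suc l)) (w (suc l) j)) ⟩
    (a′ ⊙ (λ l → w (suc l))) i j ∎
    where
    cancel : ∀ a x s t → ((a ∧ x) xor s) xor (a ∧ (x xor t)) ≡ s xor (a ∧ t)
    cancel = solve 4 (λ a x s t → ((a :* x) :+ s) :+ (a :* (x :+ t)) := s :+ (a :* t)) refl
    distrib : ∀ b a c x → (b ∧ x) xor (a ∧ (c ∧ x)) ≡ (b xor (a ∧ c)) ∧ x
    distrib = solve 4 (λ b a c x → (b :* x) :+ (a :* (c :* x)) := (b :+ (a :* c)) :* x) refl

I : ∀ {n} → Mat n n
I zero zero = true
I zero (suc _) = false
I (suc _) zero = false
I (suc i) (suc j) = I i j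

⊙-identityʳ : ∀ {k n} (X : Mat k n) → X ≐ X ⊙ I
⊙-identityʳ X i j = row (X i) j
  where
  row : ∀ {n} (x : Fin n → Bool) j → x j ≡ ∑[ l < n ] (x l ∧ I l j)
  row {suc n} x zero = sym (trans (cong (λ s → (x zero ∧ true) xor s)
    (trans (sum-cong-≗ (λ l → ∧-zeroʳ (x (suc l)))) (sum-replicate-zero n)))
    (trans (xor-identityʳ _) (∧-identityʳ (x zero))))
  row {suc n} x (suc j) = trans (row (λ l → x (suc l)) j)
    (cong (_xor ∑[ l < n ] (x (suc l) ∧ I l j)) (sym (∧-zeroʳ (x zero))))

Rows : ∀ {n k} → Matrix n → (Fin k → Fin n) → Mat k n
Rows M f i = M (f i)

independent⇒¬dependent : ∀ {n k} (M : Matrix n) {f : Fin k → Fin n} →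
  RowsIndependent M f → ¬ Dependent (Rows M f)
independent⇒¬dependent M {f} ind (c , cM≡0 , i , cᵢ)
  with trans (sym cᵢ) (ind c (λ j → trans (xsum≡sum (λ t → c t ∧ M (f t) j)) (cM≡0 j)) i)
... | ()

¬dependent⇒independent : ∀ {n k} (M : Matrix n) {f : Fin k → Fin n} →
  ¬ Dependent (Rows M f) → RowsIndependent M f
¬dependent⇒independent M {f} ¬dep c cM≡0 i =
  ¬-not λ cᵢ → ¬dep (c , (λ j → trans (sym (xsum≡sum (λ t → c t ∧ M (f t) j))) (cM≡0 j)) , i , cᵢ)

dependent? : ∀ {k n} (v : Mat k n) → Dec (Dependent v)
dependent? {k} {n} v = Π-searchable refl Bool-searchable k _ dependence-resp
  (λ c → all? (λ j → ∑[ i < k ] (c i ∧ v i j) ≟ᵇ false) ×-dec any? (λ i → c i ≟ᵇ true))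
  where
  dependence-resp : ∀ {c d} → Pointwise _≡_ c d →
    ((∀ j → ∑[ i < k ] (c i ∧ v i j) ≡ false) × ∃ λ i → c i ≡ true) →
    ((∀ j → ∑[ i < k ] (d i ∧ v i j) ≡ false) × ∃ λ i → d i ≡ true)
  dependence-resp c≗d (cv≡0 , i , cᵢ) =
    (λ j → trans (sum-cong-≗ λ t → cong (_∧ v t j) (sym (c≗d t))) (cv≡0 j)) , i , trans (sym (c≗d i)) cᵢ

independent? : ∀ {n k} (M : Matrix n) (f : Fin k → Fin n) → Dec (RowsIndependent M f)
independent? M f = map′ (¬dependent⇒independent M) (independent⇒¬dependent M) (¬? (dependent? (Rows M f)))

independent-resp : ∀ {n k} {M M′ : Matrix n} {f g : Fin k → Fin n} →
  Rows M f ≐ Rows M′ g → RowsIndependent M f → RowsIndependent M′ g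
independent-resp {M = M} {M′} {f} {g} Mf≐M′g ind c cM′≡0 = ind c λ j → begin
  xsum (λ i → c i ∧ M (f i) j)   ≡⟨ xsum≡sum (λ i → c i ∧ M (f i) j) ⟩
  sum (λ i → c i ∧ M (f i) j)    ≡⟨ sum-cong-≗ (λ i → cong (c i ∧_) (Mf≐M′g i j)) ⟩
  sum (λ i → c i ∧ M′ (g i) j)   ≡⟨ xsum≡sum (λ i → c i ∧ M′ (g i) j) ⟨
  xsum (λ i → c i ∧ M′ (g i) j)  ≡⟨ cM′≡0 j ⟩
  false ∎
  where open ≡-Reasoning

independent≤inner-dimension : ∀ {n m k} (M : Matrix n) (A : Mat n m) (W : Mat m n) → M ≐ A ⊙ W →
  {f : Fin k → Fin n} → RowsIndependent M f → k ≤ m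
independent≤inner-dimension {m = m} M A W M≐AW {f} ind = ≮⇒≥ λ m<k → independent⇒¬dependent M ind
  (fewer-generators⇒dependent m (λ i → A (f i)) W _ (λ i → M≐AW (f i)) m<k)

rank-exists : ∀ {n} (M : Matrix n) → ∃ (IsRank M)
rank-exists {n} M = map₂ (λ (basis , maximal) → basis , λ k f ind → maximal k (f , ind))
  (greatest independent-family? ((λ ()) , λ _ _ ()) n
    (λ k (f , ind) → independent≤inner-dimension M M I (⊙-identityʳ M) ind))
  where
  independent-family? : ∀ k → Dec (Σ (Fin k → Fin n) (RowsIndependent M))
  independent-family? k = Π-searchable refl Fin-searchable k (RowsIndependent M)
    (λ f≗g → independent-resp {M = M} {M} (λ i j → cong (λ x → M x j) (f≗g i))) (independent? M)

rank-unique : ∀ {n} (M : Matrix n) {r s} → IsRank M r → IsRank M s → r ≡ s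
rank-unique M ((f , indf) , maxr) ((g , indg) , maxs) = ≤-antisym (maxs _ f indf) (maxr _ g indg)

rank? : ∀ {n} (M : Matrix n) s → Dec (IsRank M s)
rank? M s with rank-exists M
... | r , rank with s ≟ℕ r
... | yes refl = yes rank
... | no s≢r = no λ rank′ → s≢r (rank-unique M rank′ rank)

rank-resp : ∀ {n} {M M′ : Matrix n} {r} → M ≐ M′ → IsRank M r → IsRank M′ r
rank-resp {M = M} {M′} M≐M′ ((f , ind) , maximal) =
  (f , independent-resp {M = M} {M′} (λ i → M≐M′ (f i)) ind) ,
  λ k g ind′ → maximal k g (independent-resp {M = M′} {M} (λ i j → sym (M≐M′ (g i) j)) ind′)

xor≡false⇒≡ : ∀ {x y} → x xor y ≡ false → x ≡ y
xor≡false⇒≡ {false} {false} _ = refl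
xor≡false⇒≡ {true} {true} _ = refl

maximal-independent⇒spanning : ∀ {n r} (M : Matrix n) {f : Fin r → Fin n} → RowsIndependent M f →
  (∀ k (g : Fin k → Fin n) → RowsIndependent M g → k ≤ r) → Σ (Mat n r) λ A → M ≐ A ⊙ Rows M f
maximal-independent⇒spanning {n} {r} M {f} ind maximal = (λ i → proj₁ (expand i)) , (λ i → proj₂ (expand i))
  where
  expand : ∀ i → Σ (Fin r → Bool) λ a → ∀ j → M i j ≡ ∑[ b < r ] (a b ∧ M (f b) j)
  expand i with dependent? (Rows {k = suc r} M (i ∷ᶠ f))
  ... | no ¬dep = contradiction (maximal (suc r) (i ∷ᶠ f) (¬dependent⇒independent M {i ∷ᶠ f} ¬dep)) 1+n≰n
  ... | yes (c , c≡0 , t , cₜ) with c zero in c₀ | t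
  ...   | true  | _ = (λ b → c (suc b)) , λ j → xor≡false⇒≡ (c≡0 j)
  ...   | false | zero = contradiction (trans (sym cₜ) c₀) λ ()
  ...   | false | suc t′ = contradiction ((λ b → c (suc b)) , c≡0 , t′ , cₜ) (independent⇒¬dependent M ind)

-- Gram factorizations of symmetric matrices

Symmetric : ∀ {k} → Mat k k → Set
Symmetric N = ∀ i j → N i j ≡ N j i

Alternating : ∀ {k} → Mat k k → Set
Alternating N = ∀ i → N i i ≡ false

EvenRows : ∀ {k m} → Mat k m → Set
EvenRows {m = m} Y = ∀ i → ∑[ l < m ] Y i l ≡ false

Factorizable : ∀ {k} → ℕ → Mat k k → Set
Factorizable {k} m N = Σ (Mat k m) λ Y → N ≐ Gram Y

Gram-diagonal : ∀ {k m} (Y : Mat k m) i → Gram Y i i ≡ ∑[ l < m ] Y i l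
Gram-diagonal Y i = sum-cong-≗ λ l → ∧-idem (Y i l)

alternating⇒even-rows : ∀ {k m} {N : Mat k k} (Y : Mat k m) → N ≐ Gram Y → Alternating N → EvenRows Y
alternating⇒even-rows Y N≐YYᵀ alt i = trans (sym (Gram-diagonal Y i)) (trans (sym (N≐YYᵀ i i)) (alt i))

even-rows⇒alternating : ∀ {k m} {N : Mat k k} (Y : Mat k m) → N ≐ Gram Y → EvenRows Y → Alternating N
even-rows⇒alternating Y N≐YYᵀ even i = trans (N≐YYᵀ i i) (trans (Gram-diagonal Y i) (even i))

Factorizable-suc : ∀ {k m} {N : Mat k k} → Factorizable m N → Factorizable (suc m) N
Factorizable-suc (Y , N≐YYᵀ) = (λ i → false ∷ᶠ Y i) , N≐YYᵀ

Factorizable-mono : ∀ {k m m′} {N : Mat k k} → m ≤ m′ → Factorizable m N → Factorizable m′ N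
Factorizable-mono m≤m′ = go (≤⇒≤′ m≤m′)
  where
  go : ∀ {m m′} {N} → m ≤′ m′ → Factorizable m N → Factorizable m′ N
  go ≤′-refl fac = fac
  go (≤′-step m≤′m′) fac = Factorizable-suc (go m≤′m′ fac)

Factorizable-reindex : ∀ {k m} {N : Mat k k} (σ τ : Fin k → Fin k) → (∀ i → σ (τ i) ≡ i) →
  Factorizable m (λ i j → N (σ i) (σ j)) → Factorizable m N
Factorizable-reindex {N = N} σ τ στ≗id (Y , Nσ≐YYᵀ) =
  (λ i → Y (τ i)) , λ i j → trans (sym (cong₂ N (στ≗id i) (στ≗id j))) (Nσ≐YYᵀ (τ i) (τ j))

lower : ∀ {k} → Mat (suc k) (suc k) → Mat k k
lower N b c = N (suc b) (suc c)

Factorizable-extend : ∀ {k m} {N : Mat (suc k) (suc k)} → Symmetric N → (∀ j → N zero j ≡ false) →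
  Factorizable m (lower N) → Factorizable m N
Factorizable-extend {k} {m} {N} sym-N row₀≡0 (Z , N′≐ZZᵀ) = Y , N≐YYᵀ
  where
  Y : Mat (suc k) m
  Y zero _ = false
  Y (suc b) = Z b
  N≐YYᵀ : N ≐ Gram Y
  N≐YYᵀ zero j = trans (row₀≡0 j) (sym (sum-replicate-zero m))
  N≐YYᵀ (suc b) zero = trans (sym-N (suc b) zero) (trans (row₀≡0 (suc b))
    (sym (trans (sum-cong-≗ λ l → ∧-zeroʳ (Z b l)) (sum-replicate-zero m))))
  N≐YYᵀ (suc b) (suc c) = N′≐ZZᵀ b c

Gram-shift : ∀ {k m} (Z : Mat k m) (p : Fin k → Bool) → EvenRows Z → ∑[ l < m ] true ≡ true →
  ∀ i j → Gram (λ i l → Z i l xor p i) i j ≡ Gram Z i j xor (p i ∧ p j)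
Gram-shift {m = m} Z p even odd i j = begin
  ∑[ l < m ] ((Z i l xor p i) ∧ (Z j l xor p j))
    ≡⟨ sum-cong-≗ (λ l → expand (Z i l) (Z j l) (p i) (p j)) ⟩
  ∑[ l < m ] ((Z i l ∧ Z j l) xor ((p j ∧ Z i l) xor ((p i ∧ Z j l) xor (p i ∧ p j))))
    ≡⟨ ∑-distrib-+ (λ l → Z i l ∧ Z j l) _ ⟩
  Gram Z i j xor ∑[ l < m ] ((p j ∧ Z i l) xor ((p i ∧ Z j l) xor (p i ∧ p j)))
    ≡⟨ cong (Gram Z i j xor_) (∑-distrib-+ (λ l → p j ∧ Z i l) _) ⟩
  Gram Z i j xor (∑[ l < m ] (p j ∧ Z i l) xor ∑[ l < m ] ((p i ∧ Z j l) xor (p i ∧ p j)))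
    ≡⟨ cong (λ s → Gram Z i j xor (∑[ l < m ] (p j ∧ Z i l) xor s)) (∑-distrib-+ (λ l → p i ∧ Z j l) _) ⟩
  Gram Z i j xor (∑[ l < m ] (p j ∧ Z i l) xor (∑[ l < m ] (p i ∧ Z j l) xor ∑[ l < m ] (p i ∧ p j)))
    ≡⟨ cong₂ (λ u v → Gram Z i j xor (u xor v)) (vanishes (p j) i) (cong₂ _xor_ (vanishes (p i) j) constant) ⟩
  Gram Z i j xor (p i ∧ p j) ∎
  where
  open ≡-Reasoning
  expand : ∀ a b p q → (a xor p) ∧ (b xor q) ≡ (a ∧ b) xor ((q ∧ a) xor ((p ∧ b) xor (p ∧ q)))
  expand = solve 4 (λ a b p q → (a :+ p) :* (b :+ q) := (a :* b) :+ ((q :* a) :+ ((p :* b) :+ (p :* q)))) refl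
  vanishes : ∀ x t → ∑[ l < m ] (x ∧ Z t l) ≡ false
  vanishes x t = trans (sym (*-distribˡ-sum x (Z t))) (trans (cong (x ∧_) (even t)) (∧-zeroʳ x))
  constant : ∑[ l < m ] (p i ∧ p j) ≡ p i ∧ p j
  constant = begin
    ∑[ l < m ] (p i ∧ p j)          ≡⟨ sum-cong-≗ {m} (λ _ → ∧-identityʳ (p i ∧ p j)) ⟨
    ∑[ l < m ] ((p i ∧ p j) ∧ true) ≡⟨ *-distribˡ-sum {m} (p i ∧ p j) (λ _ → true) ⟨
    (p i ∧ p j) ∧ ∑[ l < m ] true   ≡⟨ cong ((p i ∧ p j) ∧_) odd ⟩
    (p i ∧ p j) ∧ true              ≡⟨ ∧-identityʳ (p i ∧ p j) ⟩
    p i ∧ p j ∎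

oddCeil : ℕ → ℕ
oddCeil zero = 1
oddCeil (suc zero) = 1
oddCeil (suc (suc s)) = suc (suc (oddCeil s))

oddCeil-odd : ∀ s → ∑[ l < oddCeil s ] true ≡ true
oddCeil-odd zero = refl
oddCeil-odd (suc zero) = refl
oddCeil-odd (suc (suc s)) = trans (not-involutive _) (oddCeil-odd s)

≤oddCeil : ∀ s → s ≤ oddCeil s
≤oddCeil zero = z≤n
≤oddCeil (suc zero) = s≤s z≤n
≤oddCeil (suc (suc s)) = s≤s (s≤s (≤oddCeil s))

oddCeil≤suc : ∀ s → oddCeil s ≤ suc s
oddCeil≤suc zero = s≤s z≤n
oddCeil≤suc (suc zero) = s≤s z≤n
oddCeil≤suc (suc (suc s)) = s≤s (s≤s (oddCeil≤suc s))

even⊎oddCeil≡ : ∀ s → 2 ∣ s ⊎ oddCeil s ≡ s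
even⊎oddCeil≡ zero = inj₁ (divides 0 refl)
even⊎oddCeil≡ (suc zero) = inj₂ refl
even⊎oddCeil≡ (suc (suc s)) with even⊎oddCeil≡ s
... | inj₁ (divides q s≡q*2) = inj₁ (divides (suc q) (cong (λ t → suc (suc t)) s≡q*2))
... | inj₂ oddCeil≡s = inj₂ (cong (λ t → suc (suc t)) oddCeil≡s)

-- N + x yᵀ + y xᵀ for the first two rows x, y of N: when N is alternating with N 0 1 = 1,
-- its first two rows and columns vanish.
pair-complement : ∀ {k} → Mat (suc (suc k)) (suc (suc k)) → Mat (suc (suc k)) (suc (suc k))
pair-complement N i j = N i j xor ((N zero i ∧ N (suc zero) j) xor (N (suc zero) i ∧ N zero j))

module _ {s} {N : Mat (suc (suc s)) (suc (suc s))} (sym-N : Symmetric N) (alt-N : Alternating N)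
         (N₀₁ : N zero (suc zero) ≡ true) where

  private
    x y : Fin (suc (suc s)) → Bool
    x = N zero
    y = N (suc zero)
    Q = pair-complement N

  pair-complement-symmetric : Symmetric Q
  pair-complement-symmetric i j =
    trans (cong (_xor ((x i ∧ y j) xor (y i ∧ x j))) (sym-N i j)) (swap (N j i) (x i) (y j) (y i) (x j))
    where
    swap : ∀ n a b c d → n xor ((a ∧ b) xor (c ∧ d)) ≡ n xor ((d ∧ c) xor (b ∧ a))
    swap = solve 5 (λ n a b c d → n :+ ((a :* b) :+ (c :* d)) := n :+ ((d :* c) :+ (b :* a))) refl

  pair-complement-alternating : Alternating Q
  pair-complement-alternating i = trans (cong (_xor ((x i ∧ y i) xor (y i ∧ x i))) (alt-N i)) (cancel (x i) (y i))
    where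
    cancel : ∀ a b → (a ∧ b) xor (b ∧ a) ≡ false
    cancel = solve 2 (λ a b → (a :* b) :+ (b :* a) := con false) refl

  pair-factorization : ∀ {m} → ∑[ l < m ] true ≡ true →
    Factorizable m (lower (lower Q)) → Factorizable (suc (suc m)) N
  pair-factorization {m} odd fac = Y , N≐YYᵀ
    where
    y₀ : y zero ≡ true
    y₀ = trans (sym-N (suc zero) zero) N₀₁
    row₀ : ∀ j → Q zero j ≡ false
    row₀ j rewrite alt-N zero | y₀ = xor-same (x j)
    row₁ : ∀ j → Q (suc zero) j ≡ false
    row₁ j rewrite N₀₁ | alt-N (suc zero) = trans (cong (y j xor_) (xor-identityʳ (y j))) (xor-same (y j))
    Q-fac : Factorizable m Q
    Q-fac = Factorizable-extend pair-complement-symmetric row₀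
      (Factorizable-extend (λ b c → pair-complement-symmetric (suc b) (suc c)) (λ j → row₁ (suc j)) fac)
    Z = proj₁ Q-fac
    Y : Mat (suc (suc s)) (suc (suc m))
    Y j = x j ∷ᶠ (y j ∷ᶠ λ l → Z j l xor (x j xor y j))
    N≐YYᵀ : N ≐ Gram Y
    N≐YYᵀ i j = begin
      N i j
        ≡⟨ regroup (N i j) (x i) (x j) (y i) (y j) ⟩
      (x i ∧ x j) xor ((y i ∧ y j) xor (Q i j xor ((x i xor y i) ∧ (x j xor y j))))
        ≡⟨ cong (λ q → (x i ∧ x j) xor ((y i ∧ y j) xor (q xor _))) (proj₂ Q-fac i j) ⟩
      (x i ∧ x j) xor ((y i ∧ y j) xor (Gram Z i j xor ((x i xor y i) ∧ (x j xor y j))))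
        ≡⟨ cong (λ g → (x i ∧ x j) xor ((y i ∧ y j) xor g))
             (Gram-shift Z (λ t → x t xor y t)
               (alternating⇒even-rows Z (proj₂ Q-fac) pair-complement-alternating) odd i j) ⟨
      Gram Y i j ∎
      where
      open ≡-Reasoning
      regroup : ∀ n a b c d →
        n ≡ (a ∧ b) xor ((c ∧ d) xor ((n xor ((a ∧ d) xor (c ∧ b))) xor ((a xor c) ∧ (b xor d))))
      regroup = solve 5 (λ n a b c d →
        n := (a :* b) :+ ((c :* d) :+ ((n :+ ((a :* d) :+ (c :* b))) :+ ((a :+ c) :* (b :+ d))))) refl

-- lift 1 (transpose zero a) fixes 0 and swaps 1 with suc a.
swap-into-1-inverse : ∀ {k} (a : Fin (suc k)) i → lift 1 (transpose zero a) (lift 1 (transpose a zero) i) ≡ i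
swap-into-1-inverse a zero = refl
swap-into-1-inverse a (suc i) = cong suc (transpose-inverse zero a)

AlternatingFactorizable : ℕ → Set
AlternatingFactorizable s = ∀ (N : Mat s s) → Symmetric N → Alternating N → Factorizable (oddCeil s) N

alternating-factorization-step : ∀ s → AlternatingFactorizable s → AlternatingFactorizable (suc s) →
  AlternatingFactorizable (suc (suc s))
alternating-factorization-step s IH₀ IH₁ N sym-N alt-N with any? (λ a → N zero a ≟ᵇ true)
... | no row₀≢1 =
  Factorizable-mono (≤-trans (oddCeil≤suc (suc s)) (s≤s (s≤s (≤oddCeil s))))
    (Factorizable-extend sym-N (λ a → ¬-not λ N₀ₐ → row₀≢1 (a , N₀ₐ))
      (IH₁ (lower N) (λ b c → sym-N (suc b) (suc c)) (λ b → alt-N (suc b))))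
... | yes (zero , N₀₀) = contradiction (trans (sym N₀₀) (alt-N zero)) λ ()
... | yes (suc a , N₀ₐ) =
  Factorizable-reindex σ (lift 1 (transpose a zero)) (swap-into-1-inverse a)
    (pair-factorization sym-Nσ alt-Nσ N₀ₐ (oddCeil-odd s)
      (IH₀ (lower (lower (pair-complement (λ i j → N (σ i) (σ j)))))
        (λ b c → pair-complement-symmetric sym-Nσ alt-Nσ N₀ₐ (suc (suc b)) (suc (suc c)))
        (λ b → pair-complement-alternating sym-Nσ alt-Nσ N₀ₐ (suc (suc b)))))
  where
  σ = lift 1 (transpose zero a)
  sym-Nσ : Symmetric (λ i j → N (σ i) (σ j))
  sym-Nσ i j = sym-N (σ i) (σ j)
  alt-Nσ : Alternating (λ i j → N (σ i) (σ j))
  alt-Nσ i = alt-N (σ i)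

alternating-factorization : ∀ s → AlternatingFactorizable s
alternating-factorization zero N _ _ = (λ ()) , λ ()
alternating-factorization (suc zero) N _ alt-N = (λ _ _ → false) , λ { zero zero → alt-N zero }
alternating-factorization (suc (suc s)) =
  alternating-factorization-step s (alternating-factorization s) (alternating-factorization (suc s))

-- N + x xᵀ for the first row x of N: when N 0 0 = 1, its first row and column vanish.
pivot-complement : ∀ {k} → Mat (suc k) (suc k) → Mat (suc k) (suc k)
pivot-complement N i j = N i j xor (N zero i ∧ N zero j)

NonalternatingFactorizable : ℕ → Set
NonalternatingFactorizable s = ∀ (N : Mat s s) → Symmetric N → (∃ λ a → N a a ≡ true) → Factorizable s N

module _ {r} {N : Mat (suc r) (suc r)} (sym-N : Symmetric N) (N₀₀ : N zero zero ≡ true) where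

  private
    x : Fin (suc r) → Bool
    x = N zero
    Q = pivot-complement N

    Q-symmetric : Symmetric Q
    Q-symmetric i j = cong₂ _xor_ (sym-N i j) (∧-comm (x i) (x j))

    row₀ : ∀ j → Q zero j ≡ false
    row₀ j rewrite N₀₀ = xor-same (x j)

    N≡xxᵀ+Q : ∀ i j → N i j ≡ (x i ∧ x j) xor Q i j
    N≡xxᵀ+Q i j = solve 2 (λ n a → n := a :+ (n :+ a)) refl (N i j) (x i ∧ x j)

  pivot-factorization : NonalternatingFactorizable r → Factorizable (suc r) N
  pivot-factorization IH with any? (λ b → lower Q b b ≟ᵇ true)
  ... | yes nonalternating =
    let Z , Q≐ZZᵀ = Factorizable-extend Q-symmetric row₀
                      (IH (lower Q) (λ b c → Q-symmetric (suc b) (suc c)) nonalternating)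
    in (λ i → x i ∷ᶠ Z i) , λ i j → trans (N≡xxᵀ+Q i j) (cong ((x i ∧ x j) xor_) (Q≐ZZᵀ i j))
  ... | no ¬nonalternating =
    let Z , Q≐ZZᵀ = Factorizable-extend Q-symmetric row₀
                      (alternating-factorization r (lower Q) (λ b c → Q-symmetric (suc b) (suc c)) alt-lowerQ)
    in Factorizable-mono (oddCeil≤suc r) ((λ i l → Z i l xor x i) , λ i j → begin
      N i j                          ≡⟨ N≡xxᵀ+Q i j ⟩
      (x i ∧ x j) xor Q i j          ≡⟨ xor-comm (x i ∧ x j) (Q i j) ⟩
      Q i j xor (x i ∧ x j)          ≡⟨ cong (_xor (x i ∧ x j)) (Q≐ZZᵀ i j) ⟩
      Gram Z i j xor (x i ∧ x j)     ≡⟨ Gram-shift Z x (alternating⇒even-rows Z Q≐ZZᵀ alt-Q) (oddCeil-odd r) i j ⟨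
      Gram (λ i l → Z i l xor x i) i j ∎)
    where
    open ≡-Reasoning
    alt-lowerQ : Alternating (lower Q)
    alt-lowerQ b = ¬-not λ Q-bb → ¬nonalternating (b , Q-bb)
    alt-Q : Alternating Q
    alt-Q zero = row₀ zero
    alt-Q (suc b) = alt-lowerQ b

nonalternating-factorization : ∀ s → NonalternatingFactorizable s
nonalternating-factorization zero N _ (() , _)
nonalternating-factorization (suc r) N sym-N (a , Nₐₐ) =
  Factorizable-reindex (transpose zero a) (transpose a zero) (λ _ → transpose-inverse zero a)
    (pivot-factorization (λ i j → sym-N (transpose zero a i) (transpose zero a j)) Nₐₐ
      (nonalternating-factorization r))

⊙-cong : ∀ {k m n} {A A′ : Mat k m} {B B′ : Mat m n} → A ≐ A′ → B ≐ B′ → A ⊙ B ≐ A′ ⊙ B′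
⊙-cong A≐A′ B≐B′ i j = sum-cong-≗ λ l → cong₂ _∧_ (A≐A′ i l) (B≐B′ l j)

⊙-assoc : ∀ {a b c d} (A : Mat a b) (B : Mat b c) (C : Mat c d) → A ⊙ B ⊙ C ≐ A ⊙ (B ⊙ C)
⊙-assoc {b = b} {c} A B C i j = begin
  ∑[ l < c ] (∑[ t < b ] (A i t ∧ B t l) ∧ C l j)
    ≡⟨ sum-cong-≗ (λ l → *-distribʳ-sum (C l j) (λ t → A i t ∧ B t l)) ⟩
  ∑[ l < c ] ∑[ t < b ] ((A i t ∧ B t l) ∧ C l j)
    ≡⟨ ∑-comm (λ l t → (A i t ∧ B t l) ∧ C l j) ⟩
  ∑[ t < b ] ∑[ l < c ] ((A i t ∧ B t l) ∧ C l j)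
    ≡⟨ sum-cong-≗ (λ t → sum-cong-≗ λ l → ∧-assoc (A i t) (B t l) (C l j)) ⟩
  ∑[ t < b ] ∑[ l < c ] (A i t ∧ (B t l ∧ C l j))
    ≡⟨ sum-cong-≗ (λ t → *-distribˡ-sum (A i t) (λ l → B t l ∧ C l j)) ⟨
  ∑[ t < b ] (A i t ∧ ∑[ l < c ] (B t l ∧ C l j)) ∎
  where open ≡-Reasoning

⊙-transpose : ∀ {k m n} (A : Mat k m) (B : Mat m n) → (A ⊙ B) ᵀ ≐ B ᵀ ⊙ A ᵀ
⊙-transpose A B j i = sum-cong-≗ λ l → ∧-comm (A i l) (B l j)

Gram-⊙ : ∀ {k m n} (A : Mat k m) (Y : Mat m n) → A ⊙ (Gram Y ⊙ A ᵀ) ≐ Gram (A ⊙ Y)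
Gram-⊙ A Y i j = begin
  (A ⊙ (Y ⊙ Y ᵀ ⊙ A ᵀ)) i j
    ≡⟨ ⊙-cong {A = A} (λ _ _ → refl) (⊙-assoc Y (Y ᵀ) (A ᵀ)) i j ⟩
  (A ⊙ (Y ⊙ (Y ᵀ ⊙ A ᵀ))) i j
    ≡⟨ ⊙-assoc A Y (Y ᵀ ⊙ A ᵀ) i j ⟨
  (A ⊙ Y ⊙ (Y ᵀ ⊙ A ᵀ)) i j
    ≡⟨ ⊙-cong {A = A ⊙ Y} (λ _ _ → refl) (λ l t → sym (⊙-transpose A Y l t)) i j ⟩
  Gram (A ⊙ Y) i j ∎
  where open ≡-Reasoning

⊙-even-rows : ∀ {k m n} (A : Mat k m) (Y : Mat m n) → EvenRows Y → EvenRows (A ⊙ Y)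
⊙-even-rows {m = m} {n} A Y even i = begin
  ∑[ l < n ] ∑[ b < m ] (A i b ∧ Y b l)   ≡⟨ ∑-comm (λ l b → A i b ∧ Y b l) ⟩
  ∑[ b < m ] ∑[ l < n ] (A i b ∧ Y b l)   ≡⟨ sum-cong-≗ (λ b → *-distribˡ-sum (A i b) (Y b)) ⟨
  ∑[ b < m ] (A i b ∧ ∑[ l < n ] Y b l)   ≡⟨ sum-cong-≗ (λ b → trans (cong (A i b ∧_) (even b))
                                                                (∧-zeroʳ (A i b))) ⟩
  ∑[ b < m ] false                        ≡⟨ sum-replicate-zero m ⟩
  false ∎
  where open ≡-Reasoning

Gram-rank-bound : ∀ {n m k} (M : Matrix n) (X : Mat n m) → M ≐ Gram X →
  {f : Fin k → Fin n} → RowsIndependent M f → k ≤ m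
Gram-rank-bound M X = independent≤inner-dimension M X (X ᵀ)

-- Each row of X has even weight, so its first entry is the sum of the others; this expresses
-- every row of M through the m vectors l ↦ X j 0 + X j (1 + l).
alternating-Gram-rank-bound : ∀ {n m k} (M : Matrix n) (X : Mat n (suc m)) → M ≐ Gram X →
  Alternating M → {f : Fin k → Fin n} → RowsIndependent M f → k ≤ m
alternating-Gram-rank-bound {m = m} M X M≐XXᵀ alt-M =
  independent≤inner-dimension M (λ i l → X i (suc l)) (λ l j → X j zero xor X j (suc l)) M≐X′W
  where
  M≐X′W : M ≐ (λ i l → X i (suc l)) ⊙ (λ l j → X j zero xor X j (suc l))
  M≐X′W i j = begin
    M i j
      ≡⟨ M≐XXᵀ i j ⟩
    (X i zero ∧ X j zero) xor S
      ≡⟨ cong (λ t → (t ∧ X j zero) xor S)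
           (xor≡false⇒≡ {X i zero} {∑[ l < m ] X i (suc l)} (alternating⇒even-rows X M≐XXᵀ alt-M i)) ⟩
    (∑[ l < m ] X i (suc l) ∧ X j zero) xor S
      ≡⟨ cong (_xor S) (*-distribʳ-sum (X j zero) (λ l → X i (suc l))) ⟩
    ∑[ l < m ] (X i (suc l) ∧ X j zero) xor S
      ≡⟨ ∑-distrib-+ (λ l → X i (suc l) ∧ X j zero) (λ l → X i (suc l) ∧ X j (suc l)) ⟨
    ∑[ l < m ] ((X i (suc l) ∧ X j zero) xor (X i (suc l) ∧ X j (suc l)))
      ≡⟨ sum-cong-≗ (λ l → ∧-distribˡ-xor (X i (suc l)) (X j zero) (X j (suc l))) ⟨
    ∑[ l < m ] (X i (suc l) ∧ (X j zero xor X j (suc l))) ∎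
    where
    open ≡-Reasoning
    S = ∑[ l < m ] (X i (suc l) ∧ X j (suc l))

alternating-rank-Factorizable⇒0 : ∀ {n r} (M : Matrix n) → IsRank M r → Alternating M →
  Factorizable r M → r ≡ 0
alternating-rank-Factorizable⇒0 {r = zero} _ _ _ _ = refl
alternating-rank-Factorizable⇒0 {r = suc r} M ((f , ind) , _) alt-M (X , M≐XXᵀ) =
  contradiction (alternating-Gram-rank-bound M X M≐XXᵀ alt-M {f} ind) 1+n≰n

-- A maximal independent set of rows f spans M, so M = A R with R = Rows M f; symmetry turns
-- this into M = A N Aᵀ with N = M[f, f], and a factorization of N lifts to one of M.
module _ {n r} (M : Matrix n) (sym-M : Symmetric M) (rank : IsRank M r) where

  private
    f : Fin r → Fin n
    f = proj₁ (proj₁ rank)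
    N : Mat r r
    N a b = M (f a) (f b)
    sym-N : Symmetric N
    sym-N a b = sym-M (f a) (f b)
    spanning = maximal-independent⇒spanning M (proj₂ (proj₁ rank)) (proj₂ rank)
    A = proj₁ spanning
    M≐AR = proj₂ spanning

    M≐ANAᵀ : M ≐ A ⊙ (N ⊙ A ᵀ)
    M≐ANAᵀ = λ i j → trans (M≐AR i j) (⊙-cong {A = A} (λ _ _ → refl) R≐NAᵀ i j)
      where
      R≐NAᵀ : Rows M f ≐ N ⊙ A ᵀ
      R≐NAᵀ b j = begin
        M (f b) j                      ≡⟨ sym-M (f b) j ⟩
        M j (f b)                      ≡⟨ M≐AR j (f b) ⟩
        ∑[ c < r ] (A j c ∧ N c b)     ≡⟨ sum-cong-≗ (λ c → trans (∧-comm (A j c) (N c b))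
                                                                (cong (_∧ A j c) (sym-N c b))) ⟩
        ∑[ c < r ] (N b c ∧ A j c)     ∎
        where open ≡-Reasoning

    lift-factorization : ∀ {m} → Factorizable m N → Factorizable m M
    lift-factorization (Y , N≐YYᵀ) = A ⊙ Y , λ i j →
      trans (M≐ANAᵀ i j) (trans (⊙-cong {A = A} (λ _ _ → refl) (⊙-cong {B = A ᵀ} N≐YYᵀ (λ _ _ → refl)) i j)
        (Gram-⊙ A Y i j))

  symmetric-factorization : Factorizable (suc r) M
  symmetric-factorization with any? (λ a → N a a ≟ᵇ true)
  ... | yes nonalternating =
    Factorizable-mono (n≤1+n r) (lift-factorization (nonalternating-factorization r N sym-N nonalternating))
  ... | no ¬nonalternating = Factorizable-mono (oddCeil≤suc r)
    (lift-factorization (alternating-factorization r N sym-N λ a → ¬-not λ Nₐₐ → ¬nonalternating (a , Nₐₐ)))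

  symmetric-factorization-nonalternating : (∃ λ i → M i i ≡ true) → Factorizable r M
  symmetric-factorization-nonalternating (i , Mᵢᵢ) with any? (λ a → N a a ≟ᵇ true)
  ... | yes nonalternating = lift-factorization (nonalternating-factorization r N sym-N nonalternating)
  ... | no ¬nonalternating = contradiction (trans (sym Mᵢᵢ) (alt-M i)) λ ()
    where
    alt-N : Alternating N
    alt-N a = ¬-not λ Nₐₐ → ¬nonalternating (a , Nₐₐ)
    Y = proj₁ (alternating-factorization r N sym-N alt-N)
    N≐YYᵀ = proj₂ (alternating-factorization r N sym-N alt-N)
    alt-M : Alternating M
    alt-M = even-rows⇒alternating (A ⊙ Y) (proj₂ (lift-factorization (Y , N≐YYᵀ)))
      (⊙-even-rows A Y (alternating⇒even-rows Y N≐YYᵀ alt-N))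

  alternating⇒even-rank : Alternating M → 2 ∣ r
  alternating⇒even-rank alt-M with even⊎oddCeil≡ r
  ... | inj₁ even = even
  ... | inj₂ oddCeil≡r = subst (2 ∣_) (sym (alternating-rank-Factorizable⇒0 M rank alt-M r-columns)) (divides 0 refl)
    where
    r-columns : Factorizable r M
    r-columns = subst (λ m → Factorizable m M) oddCeil≡r
      (lift-factorization (alternating-factorization r N sym-N (λ a → alt-M (f a))))

-- Tournaments and inversions

IsTournament′ : ∀ {n} → Digraph n → Set
IsTournament′ {n} D = (∀ i → D i i ≡ false) × (∀ (i j : Fin n) → i ≢ j → D j i ≡ not (D i j))

IsTournament⇒′ : ∀ {n} {D : Digraph n} → IsTournament D → IsTournament′ D
IsTournament⇒′ {D = D} (oriented , total) = irreflexive , opposite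
  where
  irreflexive : ∀ i → D i i ≡ false
  irreflexive i = ¬-not λ Dᵢᵢ → contradiction (trans (sym Dᵢᵢ) (oriented i i Dᵢᵢ)) λ ()
  opposite : ∀ i j → i ≢ j → D j i ≡ not (D i j)
  opposite i j i≢j with D i j in Dᵢⱼ | total i j i≢j
  ... | true  | _ = oriented i j Dᵢⱼ
  ... | false | inj₁ ()
  ... | false | inj₂ Dⱼᵢ = Dⱼᵢ

IsTournament′⇒ : ∀ {n} {D : Digraph n} → IsTournament′ D → IsTournament D
IsTournament′⇒ {D = D} (irreflexive , opposite) = oriented , total
  where
  oriented : IsOriented D
  oriented i j Dᵢⱼ with i ≟ᶠ j
  ... | yes refl = contradiction (trans (sym Dᵢⱼ) (irreflexive i)) λ ()
  ... | no i≢j = trans (opposite i j i≢j) (cong not Dᵢⱼ)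
  total : ∀ i j → i ≢ j → D i j ≡ true ⊎ D j i ≡ true
  total i j i≢j with D i j in Dᵢⱼ
  ... | true = inj₁ refl
  ... | false = inj₂ (trans (opposite i j i≢j) (cong not Dᵢⱼ))

IsTournament′-resp : ∀ {n} {D D′ : Digraph n} → D ≐ D′ → IsTournament′ D → IsTournament′ D′
IsTournament′-resp D≐D′ (irreflexive , opposite) =
  (λ i → trans (sym (D≐D′ i i)) (irreflexive i)) ,
  λ i j i≢j → trans (sym (D≐D′ j i)) (trans (opposite i j i≢j) (cong not (D≐D′ i j)))

Acyclic-resp : ∀ {n} {D D′ : Digraph n} → D ≐ D′ → Acyclic D → Acyclic D′
Acyclic-resp D≐D′ acyclic (k , w , steps , closing) =
  acyclic (k , w , (λ i → trans (D≐D′ _ _) (steps i)) , trans (D≐D′ _ _) closing)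

IsTournament′? : ∀ {n} (D : Digraph n) → Dec (IsTournament′ D)
IsTournament′? D = all? (λ i → D i i ≟ᵇ false) ×-dec
  all? (λ i → all? λ j → ¬? (i ≟ᶠ j) →-dec (D j i ≟ᵇ not (D i j)))

Transitive : ∀ {n} → Digraph n → Set
Transitive {n} D = ∀ (a b c : Fin n) → D a b ≡ true → D b c ≡ true → D a c ≡ true

Transitive? : ∀ {n} (D : Digraph n) → Dec (Transitive D)
Transitive? D = all? λ a → all? λ b → all? λ c →
  (D a b ≟ᵇ true) →-dec (D b c ≟ᵇ true) →-dec (D a c ≟ᵇ true)

transitive⇒acyclic : ∀ {n} {D : Digraph n} → (∀ i → D i i ≡ false) → Transitive D → Acyclic D
transitive⇒acyclic {D = D} irreflexive transitive (k , w , steps , closing) =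
  contradiction (trans (sym (loop k w steps closing)) (irreflexive (w zero))) λ ()
  where
  path : ∀ k (w : Fin (suc (suc k)) → Fin _) → (∀ (i : Fin (suc k)) → D (w (inject₁ i)) (w (suc i)) ≡ true) →
    D (w zero) (w (fromℕ (suc k))) ≡ true
  path zero w steps = steps zero
  path (suc k) w steps =
    transitive _ _ _ (path k (λ i → w (inject₁ i)) (λ i → steps (inject₁ i))) (steps (fromℕ (suc k)))
  loop : ∀ k (w : Fin (suc k) → Fin _) → (∀ (i : Fin k) → D (w (inject₁ i)) (w (suc i)) ≡ true) →
    D (w (fromℕ k)) (w zero) ≡ true → D (w zero) (w zero) ≡ true
  loop zero w _ closing = closing
  loop (suc k) w steps closing = transitive _ _ _ (path k w steps) closing

acyclic⇒transitive : ∀ {n} {D : Digraph n} → IsTournament′ D → Acyclic D → Transitive D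
acyclic⇒transitive {n} {D} (irreflexive , opposite) acyclic a b c Dab Dbc with a ≟ᶠ c
... | yes refl = contradiction (trans (sym Dbc) (trans (opposite a b a≢b) (cong not Dab))) λ ()
  where
  a≢b : a ≢ b
  a≢b refl = contradiction (trans (sym Dab) (irreflexive a)) λ ()
... | no a≢c with D a c in Dac
...   | true = refl
...   | false = contradiction (2 , w , steps , trans (opposite a c a≢c) (cong not Dac)) acyclic
  where
  w : Fin 3 → Fin n
  w zero = a
  w (suc zero) = b
  w (suc (suc zero)) = c
  steps : ∀ (i : Fin 2) → D (w (inject₁ i)) (w (suc i)) ≡ true
  steps zero = Dab
  steps (suc zero) = Dbc

acyclic? : ∀ {n} {D : Digraph n} → IsTournament′ D → Dec (Acyclic D)
acyclic? {D = D} tournament =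
  map′ (transitive⇒acyclic (proj₁ tournament)) (acyclic⇒transitive tournament) (Transitive? D)

IsTransitiveTournament? : ∀ {n} (T : Digraph n) → Dec (IsTransitiveTournament T)
IsTransitiveTournament? T with IsTournament′? T
... | no ¬tournament = no λ (tournament , _) → ¬tournament (IsTournament⇒′ tournament)
... | yes tournament = map′ (IsTournament′⇒ tournament ,_) proj₂ (acyclic? tournament)

ordered : ∀ {n} → Digraph n
ordered zero zero = false
ordered zero (suc _) = true
ordered (suc _) zero = false
ordered (suc i) (suc j) = ordered i j

ordered-transitive-tournament : ∀ {n} → IsTransitiveTournament (ordered {n})
ordered-transitive-tournament = IsTournament′⇒ (irreflexive , opposite) , transitive⇒acyclic irreflexive transitive
  where
  irreflexive : ∀ {n} (i : Fin n) → ordered i i ≡ false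
  irreflexive zero = refl
  irreflexive (suc i) = irreflexive i
  opposite : ∀ {n} (i j : Fin n) → i ≢ j → ordered j i ≡ not (ordered i j)
  opposite zero zero i≢j = contradiction refl i≢j
  opposite zero (suc j) _ = refl
  opposite (suc i) zero _ = refl
  opposite (suc i) (suc j) i≢j = opposite i j (λ i≡j → i≢j (cong suc i≡j))
  transitive : ∀ {n} → Transitive (ordered {n})
  transitive zero (suc b) (suc c) _ _ = refl
  transitive (suc a) (suc b) (suc c) ab bc = transitive a b c ab bc

incidence : ∀ {n} (Xs : List (VSet n)) → Mat n (length Xs)
incidence (X ∷ Xs) i zero = X i
incidence (X ∷ Xs) i (suc l) = incidence Xs i l

columns : ∀ {n m} → Mat n m → List (VSet n)
columns {m = zero} X = []
columns {m = suc m} X = (λ i → X i zero) ∷ columns (λ i l → X i (suc l))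

length-columns : ∀ {n m} (X : Mat n m) → length (columns X) ≡ m
length-columns {m = zero} X = refl
length-columns {m = suc m} X = cong suc (length-columns (λ i l → X i (suc l)))

Gram-incidence-columns : ∀ {n m} (X : Mat n m) → Gram (incidence (columns X)) ≐ Gram X
Gram-incidence-columns {m = zero} X i j = refl
Gram-incidence-columns {m = suc m} X i j =
  cong ((X i zero ∧ X j zero) xor_) (Gram-incidence-columns (λ i l → X i (suc l)) i j)

invert-tournament : ∀ {n} {D : Digraph n} (X : VSet n) → IsTournament′ D → IsTournament′ (invert D X)
invert-tournament {D = D} X (irreflexive , opposite) = irreflexive′ , opposite′
  where
  irreflexive′ : ∀ i → invert D X i i ≡ false
  irreflexive′ i with X i ∧ X i
  ... | true = irreflexive i
  ... | false = irreflexive i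
  opposite′ : ∀ i j → i ≢ j → invert D X j i ≡ not (invert D X i j)
  opposite′ i j i≢j rewrite ∧-comm (X j) (X i) with X i ∧ X j
  ... | true = opposite j i (λ j≡i → i≢j (sym j≡i))
  ... | false = opposite i j i≢j

invertAll-tournament : ∀ {n} {D : Digraph n} (Xs : List (VSet n)) → IsTournament′ D → IsTournament′ (invertAll D Xs)
invertAll-tournament [] tournament = tournament
invertAll-tournament (X ∷ Xs) tournament = invertAll-tournament Xs (invert-tournament X tournament)

invertAll-off-diagonal : ∀ {n} {D : Digraph n} (Xs : List (VSet n)) → IsTournament′ D →
  ∀ {i j} → i ≢ j → invertAll D Xs i j ≡ D i j xor Gram (incidence Xs) i j
invertAll-off-diagonal {D = D} [] _ {i} {j} _ = sym (xor-identityʳ (D i j))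
invertAll-off-diagonal {D = D} (X ∷ Xs) tournament {i} {j} i≢j = begin
  invertAll (invert D X) Xs i j
    ≡⟨ invertAll-off-diagonal Xs (invert-tournament X tournament) i≢j ⟩
  invert D X i j xor Gram (incidence Xs) i j
    ≡⟨ cong (_xor Gram (incidence Xs) i j) invert-off-diagonal ⟩
  (D i j xor (X i ∧ X j)) xor Gram (incidence Xs) i j
    ≡⟨ xor-assoc (D i j) (X i ∧ X j) _ ⟩
  D i j xor ((X i ∧ X j) xor Gram (incidence Xs) i j) ∎
  where
  open ≡-Reasoning
  invert-off-diagonal : invert D X i j ≡ D i j xor (X i ∧ X j)
  invert-off-diagonal with X i ∧ X j
  ... | true = trans (proj₂ tournament i j i≢j) (sym (xor-comm (D i j) true))
  ... | false = sym (xor-identityʳ (D i j))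

AcyclicByInversions : ∀ {n} → Digraph n → ℕ → Set
AcyclicByInversions {n} D m = Σ (List (VSet n)) λ Xs → length Xs ≡ m × Acyclic (invertAll D Xs)

-- The matrix class 𝓜*(D)

matrix-searchable : ∀ {n} → Searchable (Matrix n) _≐_
matrix-searchable {n} = Π-searchable (λ _ → refl) (Π-searchable refl Bool-searchable n) n

module _ {n} {D : Digraph n} (D-tournament : IsTournament D) where

  private
    tournament : IsTournament′ D
    tournament = IsTournament⇒′ D-tournament

  inversion-Gram∈M* : (Xs : List (VSet n)) → Acyclic (invertAll D Xs) → InMstar D (Gram (incidence Xs))
  inversion-Gram∈M* Xs acyclic =
    invertAll D Xs , (IsTournament′⇒ (invertAll-tournament Xs tournament) , acyclic) , λ i j i≢j →
      sym (trans (cong (D i j xor_) (invertAll-off-diagonal Xs tournament i≢j))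
                 (solve 2 (λ d g → d :+ (d :+ g) := g) refl (D i j) (Gram (incidence Xs) i j)))

  M*-factorization⇒inversion : ∀ {m M} → InMstar D M → Factorizable m M → AcyclicByInversions D m
  M*-factorization⇒inversion (T , (T-tournament , T-acyclic) , M≐DT) (X , M≐XXᵀ) =
    columns X , length-columns X , Acyclic-resp T≐inverted T-acyclic
    where
    T≐inverted : T ≐ invertAll D (columns X)
    T≐inverted i j with i ≟ᶠ j
    ... | yes refl = trans (proj₁ (IsTournament⇒′ T-tournament) i)
                       (sym (proj₁ (invertAll-tournament (columns X) tournament) i))
    ... | no i≢j = sym (begin
      invertAll D (columns X) i j                  ≡⟨ invertAll-off-diagonal (columns X) tournament i≢j ⟩
      D i j xor Gram (incidence (columns X)) i j   ≡⟨ cong (D i j xor_) (Gram-incidence-columns X i j) ⟩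
      D i j xor Gram X i j                         ≡⟨ cong (D i j xor_) (trans (sym (M≐XXᵀ i j)) (M≐DT i j i≢j)) ⟩
      D i j xor (D i j xor T i j)                  ≡⟨ solve 2 (λ d t → d :+ (d :+ t) := t) refl (D i j) (T i j) ⟩
      T i j                                        ∎)
      where open ≡-Reasoning

  M*-symmetric : ∀ {M} → InMstar D M → Symmetric M
  M*-symmetric {M} (T , (T-tournament , _) , M≐DT) i j with i ≟ᶠ j
  ... | yes refl = refl
  ... | no i≢j = begin
    M i j                        ≡⟨ M≐DT i j i≢j ⟩
    D i j xor T i j              ≡⟨ not-xor-not (D i j) (T i j) ⟨
    not (D i j) xor not (T i j)  ≡⟨ cong₂ _xor_ (proj₂ tournament i j i≢j)
                                                (proj₂ (IsTournament⇒′ T-tournament) i j i≢j) ⟨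
    D j i xor T j i              ≡⟨ M≐DT j i (λ j≡i → i≢j (sym j≡i)) ⟨
    M j i                        ∎
    where
    open ≡-Reasoning
    not-xor-not : ∀ a b → not a xor not b ≡ a xor b
    not-xor-not = solve 2 (λ a b → (con true :+ a) :+ (con true :+ b) := a :+ b) refl

  M*-resp : ∀ {M M′} → M ≐ M′ → InMstar D M → InMstar D M′
  M*-resp M≐M′ (T , tt , M≐DT) = T , tt , λ i j i≢j → trans (sym (M≐M′ i j)) (M≐DT i j i≢j)

  M*? : ∀ M → Dec (InMstar D M)
  M*? M = matrix-searchable _ resp-T (λ T → IsTransitiveTournament? T ×-dec InM? T)
    where
    resp-T : ∀ {T T′} → T ≐ T′ →
      IsTransitiveTournament T × InM (G D T) M → IsTransitiveTournament T′ × InM (G D T′) M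
    resp-T T≐T′ ((T-tournament , T-acyclic) , M≐DT) =
      (IsTournament′⇒ (IsTournament′-resp T≐T′ (IsTournament⇒′ T-tournament)) , Acyclic-resp T≐T′ T-acyclic) ,
      λ i j i≢j → trans (M≐DT i j i≢j) (cong (D i j xor_) (T≐T′ i j))
    InM? : ∀ T → Dec (InM (G D T) M)
    InM? T = all? λ i → all? λ j → ¬? (i ≟ᶠ j) →-dec (M i j ≟ᵇ G D T i j)

  Realizable : ℕ → Set
  Realizable s = Σ (Matrix n) λ M → InMstar D M × IsRank M s

  Realizable? : ∀ s → Dec (Realizable s)
  Realizable? s = matrix-searchable _ (λ M≐M′ (M∈M* , rank) → M*-resp M≐M′ M∈M* , rank-resp M≐M′ rank)
    (λ M → M*? M ×-dec rank? M s)

  tmr-exists : ∃ (IsTmr D)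
  tmr-exists =
    let s₀ , rank₀ = rank-exists (G D ordered)
        r , realized , minimal = least Realizable? s₀
          (G D ordered , (ordered , ordered-transitive-tournament , λ _ _ _ → refl) , rank₀)
    in r , realized , λ M s M∈M* rank → minimal s (M , M∈M* , rank)

  NonalternatingRealizable : ℕ → Set
  NonalternatingRealizable r = Σ (Matrix n) λ M → (InMstar D M × IsRank M r) × ∃ λ i → M i i ≡ true

  NonalternatingRealizable? : ∀ r → Dec (NonalternatingRealizable r)
  NonalternatingRealizable? r = matrix-searchable _
    (λ M≐M′ ((M∈M* , rank) , i , Mᵢᵢ) →
      (M*-resp M≐M′ M∈M* , rank-resp M≐M′ rank) , i , trans (sym (M≐M′ i i)) Mᵢᵢ)
    (λ M → (M*? M ×-dec rank? M r) ×-dec any? (λ i → M i i ≟ᵇ true))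

  ¬nonalternating⇒zero-diagonal : ∀ {r} → ¬ NonalternatingRealizable r → MinRankZeroDiag D r
  ¬nonalternating⇒zero-diagonal ¬nonalternating M M∈M* rank i =
    ¬-not λ Mᵢᵢ → ¬nonalternating (M , (M∈M* , rank) , i , Mᵢᵢ)

  tmr≤inversions : ∀ {r} → IsTmr D r → (Xs : List (VSet n)) → Acyclic (invertAll D Xs) → r ≤ length Xs
  tmr≤inversions (_ , minimal) Xs acyclic =
    let s , rank = rank-exists (Gram (incidence Xs))
    in ≤-trans (minimal _ s (inversion-Gram∈M* Xs acyclic) rank)
               (Gram-rank-bound _ (incidence Xs) (λ _ _ → refl) (proj₂ (proj₁ rank)))

  -- If the Gram matrix of the inversion family has rank exactly tmr, it is alternating,
  -- and an alternating Gram matrix has rank less than its number of columns.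
  zero-diagonal⇒tmr<inversions : ∀ {r} → IsTmr D r → MinRankZeroDiag D r → ¬ Acyclic D →
    (Xs : List (VSet n)) → Acyclic (invertAll D Xs) → r < length Xs
  zero-diagonal⇒tmr<inversions _ _ cyclic [] acyclic = contradiction acyclic cyclic
  zero-diagonal⇒tmr<inversions {r} (_ , minimal) zero-diagonal _ (X ∷ Xs) acyclic = bound (rank-exists M)
    where
    M : Matrix n
    M = Gram (incidence (X ∷ Xs))
    M∈M* : InMstar D M
    M∈M* = inversion-Gram∈M* (X ∷ Xs) acyclic
    bound : ∃ (IsRank M) → r < suc (length Xs)
    bound (s , rank@((_ , basis-independent) , _)) =
      [ (λ r<s → <-≤-trans r<s (Gram-rank-bound M (incidence (X ∷ Xs)) (λ _ _ → refl) basis-independent))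
      , (λ r≡s → s≤s (subst (_≤ length Xs) (sym r≡s)
          (alternating-Gram-rank-bound M (incidence (X ∷ Xs)) (λ _ _ → refl)
            (zero-diagonal M M∈M* (subst (IsRank M) (sym r≡s) rank)) basis-independent))) ]′
      (m≤n⇒m<n∨m≡n (minimal M s M∈M* rank))

  nonalternating⇒acyclic-by-r : ∀ {r} → NonalternatingRealizable r → AcyclicByInversions D r
  nonalternating⇒acyclic-by-r (M , (M∈M* , rank) , nonalternating) = M*-factorization⇒inversion M∈M*
    (symmetric-factorization-nonalternating M (M*-symmetric M∈M*) rank nonalternating)

  tmr⇒acyclic-by-suc : ∀ {r} → IsTmr D r → AcyclicByInversions D (suc r)
  tmr⇒acyclic-by-suc ((M , M∈M* , rank) , _) =
    M*-factorization⇒inversion M∈M* (symmetric-factorization M (M*-symmetric M∈M*) rank)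

  private
    inv-given : ∀ {r} → IsTmr D r → Dec (Acyclic D) → Dec (NonalternatingRealizable r) → ∃ (IsInv D)
    inv-given _ (yes acyclic) _ = 0 , ([] , refl , acyclic) , λ _ _ → z≤n
    inv-given {r} tmr (no cyclic) (yes nonalternating) =
      r , nonalternating⇒acyclic-by-r nonalternating , tmr≤inversions tmr
    inv-given {r} tmr (no cyclic) (no ¬nonalternating) =
      suc r , tmr⇒acyclic-by-suc tmr ,
      zero-diagonal⇒tmr<inversions tmr (¬nonalternating⇒zero-diagonal ¬nonalternating) cyclic

  inv-exists : ∃ (IsInv D)
  inv-exists = let r , tmr = tmr-exists in inv-given tmr (acyclic? tournament) (NonalternatingRealizable? r)

  module _ {k r} (inv : IsInv D k) (tmr : IsTmr D r) where

    private
      inv≤ : ∀ {m} → AcyclicByInversions D m → k ≤ m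
      inv≤ (Xs , refl , acyclic) = proj₂ inv Xs acyclic

    tmr≤inv : r ≤ k
    tmr≤inv = let Xs , length≡k , acyclic = proj₁ inv in
      subst (r ≤_) length≡k (tmr≤inversions tmr Xs acyclic)

    inv≤suc-tmr : k ≤ suc r
    inv≤suc-tmr = inv≤ (tmr⇒acyclic-by-suc tmr)

    inv≡suc-tmr⇒zero-diagonal : k ≡ suc r → MinRankZeroDiag D r
    inv≡suc-tmr⇒zero-diagonal refl M M∈M* rank i =
      ¬-not λ Mᵢᵢ → contradiction (inv≤ (nonalternating⇒acyclic-by-r (M , (M∈M* , rank) , i , Mᵢᵢ))) 1+n≰n

    zero-diagonal⇒even-tmr : MinRankZeroDiag D r → 2 ∣ r
    zero-diagonal⇒even-tmr zero-diagonal = let M , M∈M* , rank = proj₁ tmr in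
      alternating⇒even-rank M (M*-symmetric M∈M*) rank (zero-diagonal M M∈M* rank)

    inv≡tmr⊎inv≡suc-tmr : (k ≡ r) ⊎ ((k ≡ suc r) × (2 ∣ r))
    inv≡tmr⊎inv≡suc-tmr with k ≟ℕ r
    ... | yes k≡r = inj₁ k≡r
    ... | no k≢r = inj₂ (k≡suc-r , zero-diagonal⇒even-tmr (inv≡suc-tmr⇒zero-diagonal k≡suc-r))
      where
      k≡suc-r : k ≡ suc r
      k≡suc-r = ≤-antisym inv≤suc-tmr (≤∧≢⇒< tmr≤inv λ r≡k → k≢r (sym r≡k))

    inv≡suc-tmr⇔zero-diagonal : ¬ Acyclic D → (k ≡ suc r) ⇔ MinRankZeroDiag D r
    inv≡suc-tmr⇔zero-diagonal cyclic = mk⇔ inv≡suc-tmr⇒zero-diagonal λ zero-diagonal →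
      let Xs , length≡k , acyclic = proj₁ inv in
      ≤-antisym inv≤suc-tmr (subst (r <_) length≡k (zero-diagonal⇒tmr<inversions tmr zero-diagonal cyclic Xs acyclic))

corollary3p2 : (n : ℕ) (D : Digraph n) → IsTournament D →
    (Σ ℕ λ k → IsInv D k) × (Σ ℕ λ r → IsTmr D r) ×
    ((k r : ℕ) → IsInv D k → IsTmr D r →
      ((k ≡ r) ⊎ ((k ≡ suc r) × (2 ∣ r)))
      × (¬ Acyclic D → ((k ≡ suc r) ⇔ MinRankZeroDiag D r)))
corollary3p2 n D D-tournament =
  inv-exists D-tournament , tmr-exists D-tournament ,
  λ k r inv tmr → inv≡tmr⊎inv≡suc-tmr D-tournament inv tmr , inv≡suc-tmr⇔zero-diagonal D-tournament inv tmr
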